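{- Let $p,q,k,n\in\mathbb{N}$ with $n\le\lfloor\frac{p}{k+1}\rfloor(q+1)+q+k-1$ and $p\ge k+1$. Then every $n$-vertex graph $G$ with $\mathrm{tw}(G)\le k$ has a set $S$ of at most $p$ vertices such that each component of $G-S$ has at most $q$ vertices.
   Context: $\mathrm{tw}$ denotes tree-width. -}

module Defs where

open import Data.Nat using (ℕ; zero; suc; _+_; _≤_)
open import Data.Fin using (Fin; zero; suc; inject₁; fromℕ)
open import Data.Fin.Subset using (Subset; _∈_; _∉_; ∣_∣)
open import Data.Product using (Σ; ∃; _×_; _,_)
open import Relation.Nullary using (¬_)
open import Relation.Binary.PropositionalEquality using (_≡_)
open import Function.Definitions using (Injective)
open import Level using (0ℓ)

record Graph (n : ℕ) : Set₁ where
  field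
    Adj    : Fin n → Fin n → Set
    sym    : ∀ {u v} → Adj u v → Adj v u
    irrefl : ∀ {u} → ¬ Adj u u
open Graph public

-- Reach G P u v : there is a walk from u to v in G all of whose
-- vertices satisfy P (i.e. u and v are connected in the induced subgraph G[P]).
data Reach {n : ℕ} (G : Graph n) (P : Fin n → Set) : Fin n → Fin n → Set where
  here : ∀ {v} → P v → Reach G P v v
  step : ∀ {u w v} → P u → Adj G u w → Reach G P w v → Reach G P u v

Everything : ∀ {n} → Fin n → Set
Everything _ = Data.Unit.⊤
  where import Data.Unit

Connected : ∀ {n} → Graph n → Set
Connected {n} G = ∀ (u v : Fin n) → Reach G Everything u v

-- A cycle of length l+3: injective closed walk v₀ v₁ … v_{l+2} v₀.
HasCycle : ∀ {n} → Graph n → Set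
HasCycle {n} G =
  Σ ℕ λ l → Σ (Fin (suc (suc (suc l))) → Fin n) λ f →
    Injective _≡_ _≡_ f
    × (∀ (i : Fin (suc (suc l))) → Adj G (f (inject₁ i)) (f (suc i)))
    × Adj G (f (fromℕ (suc (suc l)))) (f zero)

IsTree : ∀ {m} → Graph m → Set
IsTree G = Connected G × ¬ HasCycle G

-- A tree decomposition of G of width at most k (every bag has ≤ k+1 vertices).
-- The tree has vertex set Fin (suc m) (trees are nonempty).
record TreeDecomposition {n : ℕ} (G : Graph n) (k : ℕ) : Set₁ where
  field
    m          : ℕ
    T          : Graph (suc m)
    isTree     : IsTree T
    bag        : Fin (suc m) → Subset n
    coverVert  : ∀ (v : Fin n) → ∃ λ t → v ∈ bag t
    coverEdge  : ∀ (u v : Fin n) → Adj G u v → ∃ λ t → (u ∈ bag t × v ∈ bag t)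
    subtree    : ∀ (v : Fin n) (t t′ : Fin (suc m)) → v ∈ bag t → v ∈ bag t′ →
                 Reach T (λ s → v ∈ bag s) t t′
    width      : ∀ (t : Fin (suc m)) → ∣ bag t ∣ ≤ suc k

TwAtMost : ∀ {n} → Graph n → ℕ → Set₁
TwAtMost G k = TreeDecomposition G k

-- Every component of G - S has at most q vertices: any set C of vertices
-- all connected to some v in G - S has size ≤ q.
ComponentsAtMost : ∀ {n} → Graph n → Subset n → ℕ → Set
ComponentsAtMost {n} G S q =
  ∀ (v : Fin n) (C : Subset n) →
    (∀ w → w ∈ C → Reach G (λ x → x ∉ S) v w) → ∣ C ∣ ≤ q

-- Fix a tree decomposition of width k and a vertex set U, and call a node s light if every
-- component of T − s meets at most q vertices of U outside the bag of s; the bag of a light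
-- node is a separator. If no node is light, walking into heavy components ends at an edge ts
-- whose s-side holds more than q vertices of U while every component of T − s other than the
-- one containing t is light. Deleting the bag of s then leaves unseparated only vertices on
-- the t-side, so recursing there costs k + 1 vertices and uses up at least q + 1 vertices of
-- U per round. After ⌊p/(k+1)⌋ − 1 rounds at most 2q + k vertices remain; if both sides of ts
-- are still heavy, keeping q vertices on each side and deleting the others (at most k)
-- separates them, because no edge of G joins the two sides outside the bags of t and s.
module Submission where

open import Defs
open import Data.Nat using (ℕ; zero; suc; _+_; _*_; _≤_; _<_; z≤n; s≤s; _≤?_; _<?_)
open import Data.Nat.DivMod using (_/_; m/n*n≤m; m≥n⇒m/n>0)
open import Data.Nat.Properties
  using (≤-reflexive; ≤-trans; <-≤-trans; ≤-pred; <⇒≤; ≮⇒≥; ≰⇒>; n≤1+n; m≤m+n;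
         +-suc; +-comm; +-assoc; *-identityˡ; +-mono-≤; +-monoˡ-≤; +-monoʳ-≤; +-cancelˡ-≤; +-cancelʳ-≤;
         module ≤-Reasoning)
open import Data.Bool using (true; false)
open import Data.Fin using (Fin; zero; suc; inject₁; fromℕ; _≟_)
open import Data.Fin.Properties using (all?; ¬∀⟶∃¬)
open import Data.Fin.Subset using (Subset; _∈_; _∉_; ∣_∣; _⊆_; _∪_; _─_; ⊥; ⊤)
open import Data.Fin.Subset.Properties
  using (_∈?_; ∉⊥; ∣⊥∣≡0; ∣p∣≤n; ∣⊤∣≡n; ∈⊤; p⊆q⇒∣p∣≤∣q∣; p⊂q⇒∣p∣<∣q∣;
         x∈p∪q⁻; p⊆p∪q; q⊆p∪q; x∈p∧x∉q⇒x∈p─q; p─q⊆p)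
open import Data.Vec using ([]; _∷_; tabulate; here; there)
open import Data.Vec.Properties using (lookup∘tabulate; []=⇒lookup; lookup⇒[]=)
open import Data.List using (List; []; _∷_; length; lookup)
open import Data.List.Relation.Unary.All as All using (All; []; _∷_)
open import Data.List.Relation.Unary.All.Properties using (¬Any⇒All¬)
open import Data.List.Relation.Unary.Any using (Any; here; there; any?)
open import Data.List.Relation.Unary.AllPairs using (AllPairs; []; _∷_)
open import Data.List.Relation.Unary.Linked using (Linked; [-]; _∷_)
open import Data.Product using (Σ; ∃; _×_; _,_; proj₁; proj₂)
open import Data.Sum using (_⊎_; inj₁; inj₂; swap)
open import Data.Empty using (⊥-elim)
open import Function using (_∘_)
open import Relation.Nullary using (¬_; Dec; yes; no; does)
open import Relation.Nullary.Decidable using (_×-dec_; _⊎-dec_; ¬?)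
open import Relation.Unary using (Decidable)
open import Relation.Binary.PropositionalEquality
  using (_≡_; _≢_; refl; cong; subst; subst₂; trans) renaming (sym to ≡-sym)

private
  variable
    A : Set
    N : ℕ
    H : Graph N
    P Q : Fin N → Set
    a b c : Fin N

-- Walks

Reach-map : (∀ {x} → P x → Q x) → Reach H P a b → Reach H Q a b
Reach-map f (here p)     = here (f p)
Reach-map f (step p e r) = step (f p) e (Reach-map f r)

Reach-head : Reach H P a b → P a
Reach-head (here p)     = p
Reach-head (step p _ _) = p

Reach-last : Reach H P a b → P b
Reach-last (here p)     = p
Reach-last (step _ _ r) = Reach-last r

Reach-trans : Reach H P a b → Reach H P b c → Reach H P a c
Reach-trans (here _)     r′ = r′
Reach-trans (step p e r) r′ = step p e (Reach-trans r r′)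

Reach-sym : Reach H P a b → Reach H P b a
Reach-sym (here p) = here p
Reach-sym {H = H} (step p e r) = Reach-trans (Reach-sym r) (step (Reach-head r) (sym H e) (here p))

Reach-preserve : (∀ {x y} → P x → P y → Adj H x y → Q x → Q y) →
                 Reach H P a b → Q a → Reach H (λ x → P x × Q x) a b
Reach-preserve closed (here p)     qa = here (p , qa)
Reach-preserve closed (step p e r) qa = step (p , qa) e (Reach-preserve closed r (closed p (Reach-head r) e qa))

Reach-avoid-or-hit : ∀ t → Reach H P a b → Reach H (λ x → P x × x ≢ t) a b ⊎ Reach H P a t
Reach-avoid-or-hit t (here {v} p) with v ≟ t
... | yes refl = inj₂ (here p)
... | no  v≢t  = inj₁ (here (p , v≢t))
Reach-avoid-or-hit {a = a} t (step p e r) with a ≟ t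
... | yes refl = inj₂ (here p)
... | no  a≢t with Reach-avoid-or-hit t r
...   | inj₁ r′ = inj₁ (step (p , a≢t) e r′)
...   | inj₂ r′ = inj₂ (step p e r′)

Reach-from-last-visit : ∀ s → Reach H P a b → b ≢ s →
  Reach H (λ x → P x × x ≢ s) a b ⊎ ∃ λ u → Adj H s u × Reach H (λ x → P x × x ≢ s) u b
Reach-from-last-visit s (here p) b≢s = inj₁ (here (p , b≢s))
Reach-from-last-visit {a = a} s (step {w = w} p e r) b≢s with Reach-from-last-visit s r b≢s
... | inj₂ later = inj₂ later
... | inj₁ r′ with a ≟ s
...   | yes refl = inj₂ (w , e , r′)
...   | no  a≢s  = inj₁ (step (p , a≢s) e r′)

Adj⇒≢ : Adj H a b → a ≢ b
Adj⇒≢ {H = H} e refl = irrefl H e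

-- Paths and cycles

lastOf : A → List A → A
lastOf x []       = x
lastOf _ (y ∷ ys) = lastOf y ys

lookup-fromℕ : ∀ (x : A) xs → lookup (x ∷ xs) (fromℕ (length xs)) ≡ lastOf x xs
lookup-fromℕ x []       = refl
lookup-fromℕ x (y ∷ ys) = lookup-fromℕ y ys

Linked-lookup : ∀ {R : A → A → Set} x xs → Linked R (x ∷ xs) →
  ∀ i → R (lookup (x ∷ xs) (inject₁ i)) (lookup (x ∷ xs) (suc i))
Linked-lookup x (y ∷ ys) (e ∷ _)  zero    = e
Linked-lookup x (y ∷ ys) (_ ∷ es) (suc i) = Linked-lookup y ys es i

All-lookup : ∀ {R : A → Set} {xs} → All R xs → ∀ i → R (lookup xs i)
All-lookup (r ∷ _)  zero    = r
All-lookup (_ ∷ rs) (suc i) = All-lookup rs i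

AllPairs-lookup-injective : ∀ (xs : List A) → AllPairs _≢_ xs → ∀ i j → lookup xs i ≡ lookup xs j → i ≡ j
AllPairs-lookup-injective (x ∷ xs) (_ ∷ _)  zero    zero    _  = refl
AllPairs-lookup-injective (x ∷ xs) (x≢ ∷ _) zero    (suc j) eq = ⊥-elim (All-lookup x≢ j eq)
AllPairs-lookup-injective (x ∷ xs) (x≢ ∷ _) (suc i) zero    eq = ⊥-elim (All-lookup x≢ i (≡-sym eq))
AllPairs-lookup-injective (x ∷ xs) (_ ∷ ds) (suc i) (suc j) eq = cong suc (AllPairs-lookup-injective xs ds i j eq)

record Path (H : Graph N) (P : Fin N → Set) (a b : Fin N) : Set where
  constructor path
  field
    rest     : List (Fin N)
    linked   : Linked (Adj H) (a ∷ rest)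
    distinct : AllPairs _≢_ (a ∷ rest)
    inside   : All P (a ∷ rest)
    ends     : lastOf a rest ≡ b

Path-suffix : (π : Path H P c b) → Any (a ≡_) (c ∷ Path.rest π) → Path H P a b
Path-suffix π (here refl) = π
Path-suffix (path [] _ _ _ _) (there ())
Path-suffix (path (y ∷ ys) (_ ∷ es) (_ ∷ ds) (_ ∷ ps) end) (there a∈) = Path-suffix (path ys es ds ps end) a∈

Reach⇒Path : Reach H P a b → Path H P a b
Reach⇒Path (here p) = path [] [-] ([] ∷ []) (p ∷ []) refl
Reach⇒Path {a = a} (step {w = w} p e r) with Reach⇒Path r
... | π@(path ys es ds ps end) with any? (a ≟_) (w ∷ ys)
...   | yes a∈ = Path-suffix π a∈
...   | no  a∉ = path (w ∷ ys) (e ∷ es) (¬Any⇒All¬ (w ∷ ys) a∉ ∷ ds) (p ∷ ps) end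

neighbours-joined⇒cycle : ∀ {N} {H : Graph N} {s u u′} → Adj H s u → Adj H s u′ → u ≢ u′ →
                          Reach H (_≢ s) u u′ → HasCycle H
neighbours-joined⇒cycle {N} {H} {s} {u} e e′ u≢u′ r with Reach⇒Path r
... | path [] _ _ _ end = ⊥-elim (u≢u′ end)
... | path (y ∷ ys) es ds ps end =
  length ys , lookup cycle , (λ {i} {j} → AllPairs-lookup-injective cycle distinct i j) ,
  Linked-lookup s (u ∷ y ∷ ys) (e ∷ es) , closing
  where
    cycle : List (Fin N)
    cycle = s ∷ u ∷ y ∷ ys
    distinct : AllPairs _≢_ cycle
    distinct = All.map (λ x≢s s≡x → x≢s (≡-sym s≡x)) ps ∷ ds
    closing : Adj H (lookup cycle (fromℕ (suc (suc (length ys))))) s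
    closing = subst (λ z → Adj H z s) (≡-sym (trans (lookup-fromℕ s (u ∷ y ∷ ys)) end)) (sym H e′)

module Tree {M : ℕ} (T : Graph M) (tree : IsTree T) where

  Branch : Fin M → Fin M → Fin M → Set
  Branch s u x = Reach T (_≢ s) u x

  private
    leave : ∀ {s x} → Reach T Everything s x → x ≢ s → ∃ λ u → Adj T s u × Branch s u x
    leave {s} r x≢s with Reach-from-last-visit s r x≢s
    ... | inj₁ r′           = ⊥-elim (proj₂ (Reach-head r′) refl)
    ... | inj₂ (u , e , r′) = u , e , Reach-map proj₂ r′

  -- The neighbour of s through which x is reached (junk value s when x = s).
  toward : Fin M → Fin M → Fin M
  toward s x with x ≟ s
  ... | yes _   = s
  ... | no  x≢s = proj₁ (leave (proj₁ tree s x) x≢s)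

  toward-branch : ∀ {s x} → x ≢ s → Adj T s (toward s x) × Branch s (toward s x) x
  toward-branch {s} {x} x≢s with x ≟ s
  ... | yes x≡s  = ⊥-elim (x≢s x≡s)
  ... | no  x≢s′ = proj₂ (leave (proj₁ tree s x) x≢s′)

  toward-unique : ∀ {s u x} → Adj T s u → Branch s u x → toward s x ≡ u
  toward-unique {s} {u} {x} e r with toward-branch {s} {x} (Reach-last r)
  ... | e′ , r′ with toward s x ≟ u
  ...   | yes eq = eq
  ...   | no  ne = ⊥-elim (proj₂ tree (neighbours-joined⇒cycle e′ e ne (Reach-trans r′ (Reach-sym r))))

  toward-neighbour : ∀ {s t} → Adj T s t → toward s t ≡ t
  toward-neighbour e = toward-unique e (here (Adj⇒≢ {H = T} e ∘ ≡-sym))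

  Branch-extend : ∀ {t s u x} → Adj T t s → Adj T s u → u ≢ t → Branch s u x → Branch t s x
  Branch-extend et es u≢t r with Reach-avoid-or-hit _ r
  ... | inj₁ r′ = step (Adj⇒≢ {H = T} et ∘ ≡-sym) es (Reach-map proj₂ r′)
  ... | inj₂ r′ = ⊥-elim (u≢t (trans (≡-sym (toward-unique es r′)) (toward-neighbour (sym T et))))

  toward-not-mutual : ∀ {t s x} → Adj T t s → x ≢ t → x ≢ s → toward t x ≡ s → toward s x ≢ t
  toward-not-mutual {t} {s} {x} ets x≢t x≢s t→s s→t
    with Reach-from-last-visit s (subst (λ z → Branch t z x) t→s (proj₂ (toward-branch x≢t))) x≢s
  ... | inj₁ r′           = proj₂ (Reach-head r′) refl
  ... | inj₂ (u , e , r′) = proj₁ (Reach-head r′) (trans (≡-sym (toward-unique e (Reach-map proj₂ r′))) s→t)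

-- Counting subsets

fromDec : ∀ {n} {P : Fin n → Set} → Decidable P → Subset n
fromDec P? = tabulate (does ∘ P?)

∈fromDec⁺ : ∀ {n} {P : Fin n → Set} (P? : Decidable P) {x} → P x → x ∈ fromDec P?
∈fromDec⁺ P? {x} px = lookup⇒[]= x _ (trans (lookup∘tabulate _ x) (accepted (P? x)))
  where
    accepted : (d : Dec _) → does d ≡ true
    accepted (yes _)  = refl
    accepted (no ¬px) = ⊥-elim (¬px px)

∈fromDec⁻ : ∀ {n} {P : Fin n → Set} (P? : Decidable P) {x} → x ∈ fromDec P? → P x
∈fromDec⁻ {P = P} P? {x} x∈ = accepted (P? x) (trans (≡-sym (lookup∘tabulate _ x)) ([]=⇒lookup x∈))
  where
    accepted : (d : Dec (P x)) → does d ≡ true → P x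
    accepted (yes px) _ = px
    accepted (no _)   ()

∣p∪q∣≤∣p∣+∣q∣ : ∀ {n} (p q : Subset n) → ∣ p ∪ q ∣ ≤ ∣ p ∣ + ∣ q ∣
∣p∪q∣≤∣p∣+∣q∣ []          []          = z≤n
∣p∪q∣≤∣p∣+∣q∣ (true ∷ p)  (true ∷ q)  = s≤s (≤-trans (∣p∪q∣≤∣p∣+∣q∣ p q)
                                          (≤-trans (n≤1+n _) (≤-reflexive (≡-sym (+-suc ∣ p ∣ ∣ q ∣)))))
∣p∪q∣≤∣p∣+∣q∣ (true ∷ p)  (false ∷ q) = s≤s (∣p∪q∣≤∣p∣+∣q∣ p q)
∣p∪q∣≤∣p∣+∣q∣ (false ∷ p) (true ∷ q)  = subst (suc ∣ p ∪ q ∣ ≤_) (≡-sym (+-suc ∣ p ∣ ∣ q ∣)) (s≤s (∣p∪q∣≤∣p∣+∣q∣ p q))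
∣p∪q∣≤∣p∣+∣q∣ (false ∷ p) (false ∷ q) = ∣p∪q∣≤∣p∣+∣q∣ p q

disjoint⇒∣p∣+∣q∣≤∣p∪q∣ : ∀ {n} (p q : Subset n) → (∀ {x} → x ∈ p → x ∉ q) → ∣ p ∣ + ∣ q ∣ ≤ ∣ p ∪ q ∣
disjoint⇒∣p∣+∣q∣≤∣p∪q∣ []          []          _        = z≤n
disjoint⇒∣p∣+∣q∣≤∣p∪q∣ (true ∷ p)  (true ∷ q)  disjoint = ⊥-elim (disjoint here here)
disjoint⇒∣p∣+∣q∣≤∣p∪q∣ (true ∷ p)  (false ∷ q) disjoint =
  s≤s (disjoint⇒∣p∣+∣q∣≤∣p∪q∣ p q λ x∈p x∈q → disjoint (there x∈p) (there x∈q))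
disjoint⇒∣p∣+∣q∣≤∣p∪q∣ (false ∷ p) (true ∷ q)  disjoint =
  subst (_≤ suc ∣ p ∪ q ∣) (≡-sym (+-suc ∣ p ∣ ∣ q ∣))
    (s≤s (disjoint⇒∣p∣+∣q∣≤∣p∪q∣ p q λ x∈p x∈q → disjoint (there x∈p) (there x∈q)))
disjoint⇒∣p∣+∣q∣≤∣p∪q∣ (false ∷ p) (false ∷ q) disjoint =
  disjoint⇒∣p∣+∣q∣≤∣p∪q∣ p q λ x∈p x∈q → disjoint (there x∈p) (there x∈q)

∪-⊆ : ∀ {n} {p q r : Subset n} → p ⊆ r → q ⊆ r → p ∪ q ⊆ r
∪-⊆ {p = p} {q} p⊆r q⊆r x∈ with x∈p∪q⁻ p q x∈
... | inj₁ x∈p = p⊆r x∈p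
... | inj₂ x∈q = q⊆r x∈q

disjoint⇒∣p∣+∣q∣≤∣r∣ : ∀ {n} (p q r : Subset n) → (∀ {x} → x ∈ p → x ∉ q) → p ⊆ r → q ⊆ r →
                       ∣ p ∣ + ∣ q ∣ ≤ ∣ r ∣
disjoint⇒∣p∣+∣q∣≤∣r∣ p q r disjoint p⊆r q⊆r =
  ≤-trans (disjoint⇒∣p∣+∣q∣≤∣p∪q∣ p q disjoint) (p⊆q⇒∣p∣≤∣q∣ (∪-⊆ p⊆r q⊆r))

x∈p─q⇒x∉q : ∀ {n} (p q : Subset n) {x} → x ∈ p ─ q → x ∉ q
x∈p─q⇒x∉q (_ ∷ p) (true  ∷ q) (there x∈) (there x∈q) = x∈p─q⇒x∉q p q x∈ x∈q
x∈p─q⇒x∉q (_ ∷ p) (false ∷ q) (there x∈) (there x∈q) = x∈p─q⇒x∉q p q x∈ x∈q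

⊆-of-size : ∀ {n} (p : Subset n) j → j ≤ ∣ p ∣ → ∃ λ p′ → p′ ⊆ p × ∣ p′ ∣ ≡ j
⊆-of-size []               zero    _  = [] , (λ ()) , refl
⊆-of-size (false ∷ p)      j       j≤ with ⊆-of-size p j j≤
... | p′ , p′⊆p , size = (false ∷ p′) , (λ { (there x∈) → there (p′⊆p x∈) }) , size
⊆-of-size {suc n} (true ∷ p) zero  _  = ⊥ , (λ x∈ → ⊥-elim (∉⊥ x∈)) , ∣⊥∣≡0 (suc n)
⊆-of-size (true ∷ p)       (suc j) (s≤s j≤) with ⊆-of-size p j j≤
... | p′ , p′⊆p , size = (true ∷ p′) , (λ { here → here ; (there x∈) → there (p′⊆p x∈) }) , cong suc size

-- Arithmetic of the size budget

budget-step : ∀ {x y u c b r s} → x + y ≤ u → c ≤ y → u + 1 ≤ c + b + r + s → x + 1 ≤ b + r + s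
budget-step {x} {y} {u} {c} {b} {r} {s} x+y≤u c≤y bound = +-cancelˡ-≤ c (x + 1) (b + r + s) (begin
  c + (x + 1)       ≡⟨ +-assoc c x 1 ⟨
  c + x + 1         ≡⟨ cong (_+ 1) (+-comm c x) ⟩
  x + c + 1         ≤⟨ +-monoˡ-≤ 1 (≤-trans (+-monoʳ-≤ x c≤y) x+y≤u) ⟩
  u + 1             ≤⟨ bound ⟩
  c + b + r + s     ≡⟨ cong (_+ s) (+-assoc c b r) ⟩
  c + (b + r) + s   ≡⟨ +-assoc c (b + r) s ⟩
  c + (b + r + s)   ∎)
  where open ≤-Reasoning

budget-base : ∀ {x u q k} → x + (q + q) ≤ u → u + 1 ≤ 1 * suc q + q + k → x ≤ 1 * suc k
budget-base {x} {u} {q} {k} x+2q≤u bound = begin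
  x         ≤⟨ +-cancelʳ-≤ (q + q) x k (begin
                 x + (q + q)  ≤⟨ x+2q≤u ⟩
                 u            ≤⟨ u≤ ⟩
                 q + q + k    ≡⟨ +-comm (q + q) k ⟩
                 k + (q + q)  ∎) ⟩
  k         ≤⟨ n≤1+n k ⟩
  suc k     ≡⟨ *-identityˡ (suc k) ⟨
  1 * suc k ∎
  where
    open ≤-Reasoning
    u≤ : u ≤ q + q + k
    u≤ = ≤-pred (begin
      suc u                ≡⟨ +-comm 1 u ⟩
      u + 1                ≤⟨ bound ⟩
      1 * suc q + q + k    ≡⟨ cong (λ z → z + q + k) (*-identityˡ (suc q)) ⟩
      suc (q + q + k)      ∎)

module Decomposition {n k : ℕ} {G : Graph n} (TD : TreeDecomposition G k) where
  open TreeDecomposition TD public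
  open Tree T isTree public

  home : Fin n → Fin (suc m)
  home v = proj₁ (coverVert v)

  ∈-home : ∀ v → v ∈ bag (home v)
  ∈-home v = proj₂ (coverVert v)

  bag-≢ : ∀ {s v y} → v ∉ bag s → v ∈ bag y → y ≢ s
  bag-≢ {v = v} v∉ v∈ refl = v∉ v∈

  branch : Fin (suc m) → Fin n → Fin (suc m)
  branch s v = toward s (home v)

  -- The bags containing v span a subtree avoiding s, so they all lie in one branch at s.
  toward-bag : ∀ {s v y} → v ∉ bag s → v ∈ bag y → toward s y ≡ branch s v
  toward-bag {s} {v} {y} v∉ v∈ = toward-unique (proj₁ homeward)
    (Reach-trans (proj₂ homeward) (Reach-map (bag-≢ v∉) (subtree v (home v) y (∈-home v) v∈)))
    where
      homeward : Adj T s (branch s v) × Branch s (branch s v) (home v)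
      homeward = toward-branch (bag-≢ v∉ (∈-home v))

  branch-edge : ∀ {s v w} → Adj G v w → v ∉ bag s → w ∉ bag s → branch s v ≡ branch s w
  branch-edge {v = v} {w} e v∉ w∉ with coverEdge v w e
  ... | y , v∈ , w∈ = trans (≡-sym (toward-bag v∉ v∈)) (toward-bag w∉ w∈)

  Beyond : Fin (suc m) → Fin (suc m) → Fin n → Set
  Beyond t s v = v ∉ bag t × branch t v ≡ s

  Beyond? : ∀ t s → Decidable (Beyond t s)
  Beyond? t s v = ¬? (v ∈? bag t) ×-dec (branch t v ≟ s)

  Beyond-of-branch≢ : ∀ {t s v} → Adj T t s → v ∉ bag s → branch s v ≢ t → Beyond t s v
  Beyond-of-branch≢ {t} {s} {v} ets v∉s v↛t = v∉t , toward-unique ets beyond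
    where
      homeward : Adj T s (branch s v) × Branch s (branch s v) (home v)
      homeward = toward-branch (bag-≢ v∉s (∈-home v))
      beyond : Branch t s (home v)
      beyond = Branch-extend ets (proj₁ homeward) v↛t (proj₂ homeward)
      v∉t : v ∉ bag t
      v∉t v∈t = v↛t (trans (≡-sym (toward-bag v∉s v∈t)) (toward-neighbour (sym T ets)))

  Beyond-disjoint : ∀ {t s v} → Adj T t s → Beyond t s v → ¬ Beyond s t v
  Beyond-disjoint {v = v} ets (v∉t , t→s) (v∉s , s→t) =
    toward-not-mutual ets (bag-≢ v∉t (∈-home v)) (bag-≢ v∉s (∈-home v)) t→s s→t

  Beyond-no-edge : ∀ {t s v w} → Adj T t s → Beyond t s v → Beyond s t w → ¬ Adj G v w
  Beyond-no-edge {v = v} {w} ets (v∉t , t→s) (w∉s , s→t) e with coverEdge v w e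
  ... | y , v∈ , w∈ = toward-not-mutual ets (bag-≢ v∉t v∈) (bag-≢ w∉s w∈)
                        (trans (toward-bag v∉t v∈) t→s) (trans (toward-bag w∉s w∈) s→t)

  Beyond-cover : ∀ {t s v} → Adj T t s → ¬ (v ∈ bag t × v ∈ bag s) → Beyond t s v ⊎ Beyond s t v
  Beyond-cover {t} {s} {v} ets ¬both with v ∈? bag s
  ... | no v∉s with branch s v ≟ t
  ...   | yes s→t = inj₂ (v∉s , s→t)
  ...   | no  s↛t = inj₁ (Beyond-of-branch≢ ets v∉s s↛t)
  Beyond-cover {t} {s} {v} ets ¬both | yes v∈s with branch t v ≟ s
  ...   | yes t→s = inj₁ ((λ v∈t → ¬both (v∈t , v∈s)) , t→s)
  ...   | no  t↛s = ⊥-elim (proj₁ (Beyond-of-branch≢ (sym T ets) (λ v∈t → ¬both (v∈t , v∈s)) t↛s) v∈s)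

  Beyond-closed : ∀ {t s v w} → Adj T t s → ¬ (w ∈ bag t × w ∈ bag s) → Adj G v w →
                  Beyond t s v → Beyond t s w
  Beyond-closed ets ¬both e v-beyond with Beyond-cover ets ¬both
  ... | inj₁ w-beyond = w-beyond
  ... | inj₂ w-behind = ⊥-elim (Beyond-no-edge ets v-beyond w-behind e)

module Separation {n k : ℕ} {G : Graph n} (TD : TreeDecomposition G k) (q : ℕ) where
  open Decomposition TD

  Rest : Subset n → Subset n → Fin n → Set
  Rest U S x = x ∈ U × x ∉ S

  SmallComponents : Subset n → Subset n → Set
  SmallComponents U S = ∀ v C → (∀ w → w ∈ C → Reach G (Rest U S) v w) → ∣ C ∣ ≤ q

  SmallComponents-intro : ∀ {U S} →
    (∀ {v C} → Rest U S v → (∀ w → w ∈ C → Reach G (Rest U S) v w) → ∣ C ∣ ≤ q) → SmallComponents U S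
  SmallComponents-intro {U} {S} small v C walks with (v ∈? U) ×-dec ¬? (v ∈? S)
  ... | yes v-rest = small v-rest walks
  ... | no  ¬rest  = ≤-trans (≤-trans (p⊆q⇒∣p∣≤∣q∣ C⊆⊥) (≤-reflexive (∣⊥∣≡0 n))) z≤n
    where
      C⊆⊥ : C ⊆ ⊥
      C⊆⊥ {w} w∈C = ⊥-elim (¬rest (Reach-head (walks w w∈C)))

  Separator : ℕ → Subset n → Set
  Separator a U = Σ (Subset n) λ S → ∣ S ∣ ≤ a * suc k × SmallComponents U S

  beyond? : ∀ t s U v → Dec (Beyond t s v × v ∈ U)
  beyond? t s U v = Beyond? t s v ×-dec (v ∈? U)

  beyond : Fin (suc m) → Fin (suc m) → Subset n → Subset n
  beyond t s U = fromDec (beyond? t s U)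

  ∈beyond⁻ : ∀ {t s U v} → v ∈ beyond t s U → Beyond t s v × v ∈ U
  ∈beyond⁻ {t} {s} {U} = ∈fromDec⁻ (beyond? t s U)

  ∈beyond⁺ : ∀ {t s U v} → Beyond t s v → v ∈ U → v ∈ beyond t s U
  ∈beyond⁺ {t} {s} {U} v-beyond v∈U = ∈fromDec⁺ (beyond? t s U) (v-beyond , v∈U)

  -- As x ranges over the nodes other than s, toward s x ranges over the neighbours of s;
  -- quantifying over nodes keeps lightness decidable.
  Light : Fin (suc m) → Subset n → Set
  Light s U = ∀ x → x ≢ s → ∣ beyond s (toward s x) U ∣ ≤ q

  OthersLight : Fin (suc m) → Fin (suc m) → Subset n → Set
  OthersLight t s U = ∀ x → x ≢ s → toward s x ≢ t → ∣ beyond s (toward s x) U ∣ ≤ q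

  record HeavyEdge (U : Subset n) : Set where
    constructor heavyEdge
    field
      {t s}       : Fin (suc m)
      edge        : Adj T t s
      heavyᵗ      : q < ∣ beyond t s U ∣
      heavyˢ      : q < ∣ beyond s t U ∣
      othersLight : OthersLight t s U

  side? : ∀ t s x → Dec (x ≢ t × toward t x ≡ s)
  side? t s x = ¬? (x ≟ t) ×-dec (toward t x ≟ s)

  side : Fin (suc m) → Fin (suc m) → Subset (suc m)
  side t s = fromDec (side? t s)

  side-shrinks : ∀ {t s u} → Adj T t s → Adj T s u → u ≢ t → ∣ side s u ∣ < ∣ side t s ∣
  side-shrinks {t} {s} {u} ets esu u≢t =
    p⊂q⇒∣p∣<∣q∣ (inner⊆outer , s , ∈fromDec⁺ (side? t s) (s≢t , toward-neighbour ets) ,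
                 λ s∈ → proj₁ (∈fromDec⁻ (side? s u) s∈) refl)
    where
      s≢t : s ≢ t
      s≢t = Adj⇒≢ {H = T} ets ∘ ≡-sym
      inner⊆outer : side s u ⊆ side t s
      inner⊆outer {x} x∈ with ∈fromDec⁻ (side? s u) x∈
      ... | x≢s , s→u = ∈fromDec⁺ (side? t s) (Reach-last extended , toward-unique ets extended)
        where
          extended : Branch t s x
          extended = Branch-extend ets esu u≢t (subst (λ z → Branch s z _) s→u (proj₂ (toward-branch x≢s)))

  light? : ∀ U s x → Dec (x ≡ s ⊎ ∣ beyond s (toward s x) U ∣ ≤ q)
  light? U s x = (x ≟ s) ⊎-dec (∣ beyond s (toward s x) U ∣ ≤? q)

  settled? : ∀ U t s x → Dec (x ≡ s ⊎ toward s x ≡ t ⊎ ∣ beyond s (toward s x) U ∣ ≤ q)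
  settled? U t s x = (x ≟ s) ⊎-dec (toward s x ≟ t) ⊎-dec (∣ beyond s (toward s x) U ∣ ≤? q)

  -- Each move t → s → u into a heavy branch strictly shrinks the component of T − t containing s.
  follow-heavy : ∀ U (fuel : ℕ) {t s} → Adj T t s → q < ∣ beyond t s U ∣ → ∣ side t s ∣ < fuel →
                 (∃ λ s → Light s U) ⊎ HeavyEdge U
  follow-heavy U (suc fuel) {t} {s} ets heavyᵗ shrinking with all? (settled? U t s)
  ... | yes settled with q <? ∣ beyond s t U ∣
  ...   | yes heavyˢ = inj₂ (heavyEdge ets heavyᵗ heavyˢ othersLight)
    where
      othersLight : OthersLight t s U
      othersLight x x≢s s↛t with settled x
      ... | inj₁ x≡s        = ⊥-elim (x≢s x≡s)
      ... | inj₂ (inj₁ s→t) = ⊥-elim (s↛t s→t)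
      ... | inj₂ (inj₂ ≤q)  = ≤q
  ...   | no  ¬heavyˢ = inj₁ (s , light)
    where
      light : Light s U
      light x x≢s with settled x
      ... | inj₁ x≡s        = ⊥-elim (x≢s x≡s)
      ... | inj₂ (inj₁ s→t) = subst (λ z → ∣ beyond s z U ∣ ≤ q) (≡-sym s→t) (≮⇒≥ ¬heavyˢ)
      ... | inj₂ (inj₂ ≤q)  = ≤q
  follow-heavy U (suc fuel) {t} {s} ets heavyᵗ shrinking | no unsettled
    with ¬∀⟶∃¬ _ _ (settled? U t s) unsettled
  ... | x , ¬settled = follow-heavy U fuel ets′ (≰⇒> (¬settled ∘ inj₂ ∘ inj₂))
                         (<-≤-trans (side-shrinks ets ets′ (¬settled ∘ inj₂ ∘ inj₁)) (≤-pred shrinking))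
    where
      ets′ : Adj T s (toward s x)
      ets′ = proj₁ (toward-branch (¬settled ∘ inj₁))

  light-or-heavy : ∀ U → (∃ λ s → Light s U) ⊎ HeavyEdge U
  light-or-heavy U with all? (light? U zero)
  ... | yes settled = inj₁ (zero , light)
    where
      light : Light zero U
      light x x≢0 with settled x
      ... | inj₁ x≡0 = ⊥-elim (x≢0 x≡0)
      ... | inj₂ ≤q  = ≤q
  ... | no unsettled with ¬∀⟶∃¬ _ _ (light? U zero) unsettled
  ... | x , ¬settled = follow-heavy U (suc (suc m)) (proj₁ (toward-branch (¬settled ∘ inj₁)))
                         (≰⇒> (¬settled ∘ inj₂)) (s≤s (∣p∣≤n (side zero _)))

  Reach-branch : ∀ {U S s v w} → bag s ⊆ S → Reach G (Rest U S) v w →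
                 Reach G (λ x → Rest U S x × branch s x ≡ branch s v) v w
  Reach-branch {U} {S} {s} {v} bag⊆S r = Reach-preserve step-keeps r refl
    where
      step-keeps : ∀ {x y} → Rest U S x → Rest U S y → Adj G x y →
                   branch s x ≡ branch s v → branch s y ≡ branch s v
      step-keeps (_ , x∉S) (_ , y∉S) e x-branch =
        trans (≡-sym (branch-edge e (x∉S ∘ bag⊆S) (y∉S ∘ bag⊆S))) x-branch

  component⊆beyond : ∀ {U S s v C} → bag s ⊆ S → (∀ w → w ∈ C → Reach G (Rest U S) v w) →
                     C ⊆ beyond s (branch s v) U
  component⊆beyond bag⊆S walks {w} w∈C with Reach-last (Reach-branch bag⊆S (walks w w∈C))
  ... | (w∈U , w∉S) , w-branch = ∈beyond⁺ (w∉S ∘ bag⊆S , w-branch) w∈U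

  light⇒small : ∀ {s U} → Light s U → SmallComponents U (bag s)
  light⇒small {s} light = SmallComponents-intro λ { {v} (_ , v∉s) walks →
    ≤-trans (p⊆q⇒∣p∣≤∣q∣ (component⊆beyond (λ x∈ → x∈) walks)) (light (home v) (bag-≢ v∉s (∈-home v))) }

  confined : ∀ {t s U S A B v C} → Adj T t s → A ⊆ beyond t s U → B ⊆ beyond s t U →
             (∀ {x} → Rest U S x → x ∈ A ⊎ x ∈ B) → v ∈ A →
             (∀ w → w ∈ C → Reach G (Rest U S) v w) → C ⊆ A
  confined {t} {s} {U} {S} {A} {B} ets A⊆ B⊆ cover v∈A walks {w} w∈C = stays (cover (proj₁ w-end)) (proj₂ w-end)
    where
      outside-both : ∀ {x} → Rest U S x → ¬ (x ∈ bag t × x ∈ bag s)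
      outside-both x-rest (x∈t , x∈s) with cover x-rest
      ... | inj₁ x∈A = proj₁ (proj₁ (∈beyond⁻ (A⊆ x∈A))) x∈t
      ... | inj₂ x∈B = proj₁ (proj₁ (∈beyond⁻ (B⊆ x∈B))) x∈s
      w-end : Rest U S w × Beyond t s w
      w-end = Reach-last (Reach-preserve (λ _ y-rest → Beyond-closed ets (outside-both y-rest))
                                         (walks w w∈C) (proj₁ (∈beyond⁻ (A⊆ v∈A))))
      stays : w ∈ A ⊎ w ∈ B → Beyond t s w → w ∈ A
      stays (inj₁ w∈A) _        = w∈A
      stays (inj₂ w∈B) w-beyond = ⊥-elim (Beyond-disjoint ets w-beyond (proj₁ (∈beyond⁻ (B⊆ w∈B))))

  both-sides-kept : ∀ {t s U A B} → Adj T t s → A ⊆ beyond t s U → B ⊆ beyond s t U →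
                    ∣ A ∣ ≤ q → ∣ B ∣ ≤ q → SmallComponents U (U ─ (A ∪ B))
  both-sides-kept {U = U} {A} {B} ets A⊆ B⊆ ∣A∣≤q ∣B∣≤q = SmallComponents-intro component
    where
      kept : ∀ {x} → Rest U (U ─ (A ∪ B)) x → x ∈ A ⊎ x ∈ B
      kept {x} (x∈U , x∉removed) with x ∈? A ∪ B
      ... | yes x∈kept = x∈p∪q⁻ A B x∈kept
      ... | no  x∉kept = ⊥-elim (x∉removed (x∈p∧x∉q⇒x∈p─q x∈U x∉kept))
      component : ∀ {v C} → Rest U (U ─ (A ∪ B)) v →
                  (∀ w → w ∈ C → Reach G (Rest U (U ─ (A ∪ B))) v w) → ∣ C ∣ ≤ q
      component v-rest walks with kept v-rest
      ... | inj₁ v∈A = ≤-trans (p⊆q⇒∣p∣≤∣q∣ (confined ets A⊆ B⊆ kept v∈A walks)) ∣A∣≤q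
      ... | inj₂ v∈B = ≤-trans (p⊆q⇒∣p∣≤∣q∣ (confined (sym T ets) B⊆ A⊆ (swap ∘ kept) v∈B walks)) ∣B∣≤q

  separator-base : ∀ {U} → HeavyEdge U → ∣ U ∣ + 1 ≤ 1 * suc q + q + k → Separator 1 U
  separator-base {U} (heavyEdge {t} {s} ets heavyᵗ heavyˢ _) budget
    with ⊆-of-size (beyond t s U) q (<⇒≤ heavyᵗ) | ⊆-of-size (beyond s t U) q (<⇒≤ heavyˢ)
  ... | A , A⊆ , ∣A∣≡q | B , B⊆ , ∣B∣≡q =
    U ─ (A ∪ B) , budget-base {q = q} {k = k} (≤-trans (+-monoʳ-≤ _ 2q≤kept) removed+kept) budget ,
    both-sides-kept ets A⊆ B⊆ (≤-reflexive ∣A∣≡q) (≤-reflexive ∣B∣≡q)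
    where
      2q≤kept : q + q ≤ ∣ A ∪ B ∣
      2q≤kept = subst₂ (λ i j → i + j ≤ ∣ A ∪ B ∣) ∣A∣≡q ∣B∣≡q (disjoint⇒∣p∣+∣q∣≤∣p∪q∣ A B λ x∈A x∈B →
                  Beyond-disjoint ets (proj₁ (∈beyond⁻ (A⊆ x∈A))) (proj₁ (∈beyond⁻ (B⊆ x∈B))))
      removed+kept : ∣ U ─ (A ∪ B) ∣ + ∣ A ∪ B ∣ ≤ ∣ U ∣
      removed+kept = disjoint⇒∣p∣+∣q∣≤∣r∣ (U ─ (A ∪ B)) (A ∪ B) U (x∈p─q⇒x∉q U (A ∪ B)) (p─q⊆p U (A ∪ B))
                       (∪-⊆ (proj₂ ∘ ∈beyond⁻ ∘ A⊆) (proj₂ ∘ ∈beyond⁻ ∘ B⊆))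

  beyond-sides : ∀ {t s U} → Adj T t s → ∣ beyond t s U ∣ + ∣ beyond s t U ∣ ≤ ∣ U ∣
  beyond-sides {U = U} ets = disjoint⇒∣p∣+∣q∣≤∣r∣ _ _ U
    (λ x∈ᵗ x∈ˢ → Beyond-disjoint ets (proj₁ (∈beyond⁻ x∈ᵗ)) (proj₁ (∈beyond⁻ x∈ˢ)))
    (proj₂ ∘ ∈beyond⁻) (proj₂ ∘ ∈beyond⁻)

  separator-step : ∀ {a b U} → HeavyEdge U → ∣ U ∣ + 1 ≤ suc q + b + q + k →
                   (∀ U′ → ∣ U′ ∣ + 1 ≤ b + q + k → Separator a U′) → Separator (suc a) U
  separator-step {U = U} (heavyEdge {t} {s} ets heavyᵗ _ othersLight) budget recurse
    with recurse (beyond s t U) (budget-step (beyond-sides (sym T ets)) heavyᵗ budget)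
  ... | S′ , ∣S′∣≤ , small′ =
    bag s ∪ S′ , ≤-trans (∣p∪q∣≤∣p∣+∣q∣ (bag s) S′) (+-mono-≤ (width s) ∣S′∣≤) ,
    SmallComponents-intro component
    where
      component : ∀ {v C} → Rest U (bag s ∪ S′) v →
                  (∀ w → w ∈ C → Reach G (Rest U (bag s ∪ S′)) v w) → ∣ C ∣ ≤ q
      component {v} {C} (_ , v∉S) walks with branch s v ≟ t
      ... | no  s↛t = ≤-trans (p⊆q⇒∣p∣≤∣q∣ (component⊆beyond (p⊆p∪q S′) walks))
                        (othersLight (home v) (bag-≢ (v∉S ∘ p⊆p∪q S′) (∈-home v)) s↛t)
      ... | yes s→t = small′ v C λ w w∈C →
        Reach-map (λ { ((x∈U , x∉S) , x-branch) → ∈beyond⁺ (x∉S ∘ p⊆p∪q S′ , trans x-branch s→t) x∈U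
                                                 , x∉S ∘ q⊆p∪q (bag s) S′ })
                  (Reach-branch (p⊆p∪q S′) (walks w w∈C))

  separator : ∀ a U → ∣ U ∣ + 1 ≤ a * suc q + q + k → 1 ≤ a → Separator a U
  separator (suc a) U budget _ with light-or-heavy U
  ... | inj₁ (s , light) = bag s , ≤-trans (width s) (m≤m+n (suc k) (a * suc k)) , light⇒small light
  separator (suc zero)    U budget _ | inj₂ heavy = separator-base heavy budget
  separator (suc (suc a)) U budget _ | inj₂ heavy =
    separator-step {a = suc a} heavy budget λ U′ budget′ → separator (suc a) U′ budget′ (s≤s z≤n)

theorem22 : (p q k n : ℕ) → n + 1 ≤ (p / suc k) * suc q + q + k → suc k ≤ p →
    (G : Graph n) → TwAtMost G k →
    Σ (Subset n) λ S → ∣ S ∣ ≤ p × ComponentsAtMost G S q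
theorem22 p q k n budget k<p G td
  with Separation.separator td q (p / suc k) ⊤ (subst (λ z → z + 1 ≤ _) (≡-sym (∣⊤∣≡n n)) budget) (m≥n⇒m/n>0 k<p)
... | S , ∣S∣≤ , small =
  S , ≤-trans ∣S∣≤ (m/n*n≤m p (suc k)) , λ v C walks → small v C λ w w∈C → Reach-map (∈⊤ ,_) (walks w w∈C)
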